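{- Let $p$ be a prime, let $A$ be a matrix over $GF(p)$ whose columns are labelled by a finite set $E$, let $M=M[A]$, let $a,b\in E$ be distinct, $\alpha\in GF(p)\setminus\{0\}$, and let $M_{a,b}$ be the splitting matroid, with rank functions $r$ of $M$ and $r'$ of $M_{a,b}$. Then: (1) $r'(M_{a,b})=r(M)$ if and only if every circuit of $M$ is either a $p$-circuit or disjoint from $\{a,b\}$; moreover, in this case $M\cong M_{a,b}$. (2) If $M$ contains an $np$-circuit, then $r'(M_{a,b})=r(M)+1$.
   Context: The splitting matroid $M_{a,b}$ is $M[A_{a,b}]$, where $A_{a,b}$ is $A$ with an appended row having entries $\alpha$ in columns $a,b$ and $0$ elsewhere. For a circuit $C$ of $M$, its columns satisfy $\sum_{u\in C}c_u u=0$ over $GF(p)$ with all $c_u\ne0$ (unique up to nonzero scalar). $C$ is a $p$-circuit if $a,b\in C$ and $c_a+c_b=0$; an $np$-circuit if $|C\cap\{a,b\}|=1$, or $a,b\in C$ and $c_a+c_b\ne0$. -}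

module Defs where

open import Data.Nat using (ℕ; zero; suc; NonZero; _+_; _*_; _≤_)
open import Data.Nat.DivMod using (_mod_)
open import Data.Fin using (Fin; zero; suc; toℕ; _≟_)
open import Data.Fin.Subset using (Subset; _∈_; _∉_; _⊆_; _⊂_; ∣_∣)
open import Data.Vec using (tabulate; lookup)
open import Data.Bool using (if_then_else_; _∨_)
open import Data.Product using (Σ; ∃; _×_)
open import Data.Sum using (_⊎_)
open import Function using (_∘_)
open import Function.Bundles using (_↔_; _⇔_; Inverse)
open import Relation.Nullary using (¬_; does)
open import Relation.Binary.PropositionalEquality using (_≡_; _≢_)

-- Matrices over GF(p) = ℤ/pℤ, elements represented by Fin p.
-- Columns are labelled by the finite set E = Fin n; there are m rows.
Matrix : (p m n : ℕ) → Set
Matrix p m n = Fin m → Fin n → Fin p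

module _ {p : ℕ} .{{_ : NonZero p}} where

  infixl 6 _+ₚ_
  infixl 7 _*ₚ_

  0ₚ : Fin p
  0ₚ = 0 mod p

  _+ₚ_ : Fin p → Fin p → Fin p
  x +ₚ y = (toℕ x + toℕ y) mod p

  _*ₚ_ : Fin p → Fin p → Fin p
  x *ₚ y = (toℕ x * toℕ y) mod p

  Σₚ : ∀ {n} → (Fin n → Fin p) → Fin p
  Σₚ {zero} f = 0ₚ
  Σₚ {suc n} f = f zero +ₚ Σₚ (f ∘ suc)

  IsDependency : ∀ {m n} → Matrix p m n → (Fin n → Fin p) → Set
  IsDependency A c = ∀ i → Σₚ (λ u → c u *ₚ A i u) ≡ 0ₚ

  SupportedOn : ∀ {n} → (Fin n → Fin p) → Subset n → Set
  SupportedOn c X = ∀ u → u ∉ X → c u ≡ 0ₚ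

  Independent : ∀ {m n} → Matrix p m n → Subset n → Set
  Independent A X =
    ∀ c → SupportedOn c X → IsDependency A c → ∀ u → c u ≡ 0ₚ

  Dependent : ∀ {m n} → Matrix p m n → Subset n → Set
  Dependent A X = ¬ Independent A X

  IsRankOf : ∀ {m n} → Matrix p m n → Subset n → ℕ → Set
  IsRankOf A X k =
    (∃ λ Y → Y ⊆ X × Independent A Y × ∣ Y ∣ ≡ k)
    × (∀ Y → Y ⊆ X → Independent A Y → ∣ Y ∣ ≤ k)

  MatroidRank : ∀ {m n} → Matrix p m n → ℕ → Set
  MatroidRank {n = n} A k = IsRankOf A (Data.Fin.Subset.⊤) k

  IsCircuit : ∀ {m n} → Matrix p m n → Subset n → Set
  IsCircuit A C = Dependent A C × (∀ D → D ⊂ C → Independent A D)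

  CircuitCoeffs : ∀ {m n} → Matrix p m n → Subset n → (Fin n → Fin p) → Set
  CircuitCoeffs A C c =
    IsDependency A c × (∀ u → (u ∈ C → c u ≢ 0ₚ) × (u ∉ C → c u ≡ 0ₚ))

  IsPCircuit : ∀ {m n} → Matrix p m n → Fin n → Fin n → Subset n → Set
  IsPCircuit A a b C =
    IsCircuit A C × a ∈ C × b ∈ C
    × (∃ λ c → CircuitCoeffs A C c × c a +ₚ c b ≡ 0ₚ)

  IsNPCircuit : ∀ {m n} → Matrix p m n → Fin n → Fin n → Subset n → Set
  IsNPCircuit A a b C =
    IsCircuit A C
    × ( (a ∈ C × b ∉ C)
      ⊎ (a ∉ C × b ∈ C)
      ⊎ (a ∈ C × b ∈ C × (∃ λ c → CircuitCoeffs A C c × c a +ₚ c b ≢ 0ₚ)))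

  splitRow : ∀ {n} → Fin n → Fin n → Fin p → Fin n → Fin p
  splitRow a b α u = if does (u ≟ a) ∨ does (u ≟ b) then α else 0ₚ

appendRow : ∀ {A : Set} {m n} → (Fin m → Fin n → A) → (Fin n → A) → Fin (suc m) → Fin n → A
appendRow {m = zero} A r zero = r
appendRow {m = suc m} A r zero = A zero
appendRow {m = suc m} A r (suc i) = appendRow (A ∘ suc) r i

splitMatrix : ∀ {p m n} .{{_ : NonZero p}} → Matrix p m n → Fin n → Fin n → Fin p → Matrix p (suc m) n
splitMatrix A a b α = appendRow A (splitRow a b α)

image : ∀ {n} → (Fin n ↔ Fin n) → Subset n → Subset n
image σ X = tabulate (λ v → lookup X (Inverse.from σ v))

Isomorphic : ∀ {p m m' n} .{{_ : NonZero p}} → Matrix p m n → Matrix p m' n → Set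
Isomorphic {n = n} A B =
  Σ (Fin n ↔ Fin n) λ σ → ∀ X → Independent A X ⇔ Independent B (image σ X)

{-# OPTIONS --safe #-}

-- A vector c is a dependency of A_{a,b} exactly when it is a dependency of A that is
-- balanced, c_a + c_b = 0, because α ≠ 0 and GF(p) has no zero divisors. If every
-- dependency of A is balanced, M and M_{a,b} have the same independent sets. Otherwise fix
-- a basis B of M: the fundamental dependencies, supported on B ∪ {x} for x ∉ B, span all
-- dependencies, so one of them, d, is unbalanced. Then B ∪ {x} is independent in M_{a,b};
-- and if Y is independent in M_{a,b} but carries a dependency e of M with e_u ≠ 0, then Y - u
-- is independent in M. Hence r' = r + 1. The support of d is a circuit that is neither a
-- p-circuit nor disjoint from {a,b}, whereas the coefficients of an np-circuit are unbalanced.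
module Submission where

open import Defs

open import Data.Nat as ℕ using (ℕ; zero; suc; NonZero; _%_; _+_; _*_; _≤_)
open import Data.Nat.Properties as ℕ using ()
open import Data.Nat.DivMod using (_mod_; m%n%n≡m%n; m<n⇒m%n≡m; %-distribˡ-+; %-distribˡ-*; m*n%n≡0)
open import Data.Nat.Divisibility using (_∣_; m%n≡0⇒n∣m; n∣m⇒m%n≡0)
open import Data.Nat.Primality using (Prime; euclidsLemma)
open import Data.Nat.Coprimality using (prime⇒coprime; coprime-Bézout)
open import Data.Nat.GCD using (module Bézout)
open import Data.Nat.Tactic.RingSolver using (solve-∀)
open import Data.Bool using (not)
open import Data.Bool.Properties using (∨-zeroʳ)
open import Data.Fin as Fin using (Fin; zero; suc; toℕ; finToFun; funToFin)
open import Data.Fin.Properties using (toℕ-injective; toℕ-fromℕ<; toℕ<n; suc-injective; any?; all?; finToFun-funToFin)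
open import Data.Fin.Subset using (Subset; inside; outside; _∈_; _∉_; _⊆_; _⊂_; _∪_; ⁅_⁆; _-_; ∣_∣)
open import Data.Fin.Subset.Properties using (_∈?_; ⊆⊤; p─⊥≡p; p─q⊆p; p⊆p∪q; x∈p∪q⁻; x∈p∪q⁺; x∈⁅x⁆; x∈⁅y⁆⇒x≡y; p⊂q⇒∣p∣<∣q∣; x∈p⇒p-x⊂p; x∈p∧x≢y⇒x∈p-y)
open import Data.Vec using (_∷_; tabulate; here; there)
open import Data.Vec.Properties using ([]=⇒lookup; lookup⇒[]=; lookup∘tabulate; tabulate∘lookup)
open import Data.List using ([]; _∷_; allFin)
open import Data.List.Membership.Propositional using () renaming (_∉_ to _∉ₗ_)
open import Data.List.Membership.Propositional.Properties using (∈-allFin)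
open import Data.List.Relation.Unary.Any using (here; there)
open import Data.Product using (∃; _×_; _,_; proj₁; proj₂)
open import Data.Sum as Sum using (_⊎_; inj₁; inj₂)
open import Function using (_∘_; flip; id)
open import Function.Bundles using (_⇔_; mk⇔)
open import Function.Construct.Identity using (↔-id)
open import Relation.Nullary using (¬_; Dec; yes; no; does; contradiction; ¬?)
open import Relation.Nullary.Decidable using (decidable-stable; dec-true; _×-dec_; _→-dec_)
open import Relation.Binary.PropositionalEquality

-- Finite sets

x∉p-x : ∀ {n} (X : Subset n) x → x ∉ X - x
x∉p-x (_ ∷ X) (suc x) (there x∈X-x) = x∉p-x X x x∈X-x

∣p∣≤1+∣p-x∣ : ∀ {n} (X : Subset n) x → ∣ X ∣ ≤ suc ∣ X - x ∣
∣p∣≤1+∣p-x∣ (inside  ∷ X) zero    = ℕ.s≤s (ℕ.≤-reflexive (cong ∣_∣ (sym (p─⊥≡p X))))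
∣p∣≤1+∣p-x∣ (outside ∷ X) zero    = ℕ.m≤n⇒m≤1+n (ℕ.≤-reflexive (cong ∣_∣ (sym (p─⊥≡p X))))
∣p∣≤1+∣p-x∣ (inside  ∷ X) (suc x) = ℕ.s≤s (∣p∣≤1+∣p-x∣ X x)
∣p∣≤1+∣p-x∣ (outside ∷ X) (suc x) = ∣p∣≤1+∣p-x∣ X x

∉-∪⁅⁆ : ∀ {n} {X : Subset n} {x v} → v ∉ X → v ≢ x → v ∉ X ∪ ⁅ x ⁆
∉-∪⁅⁆ v∉X v≢x v∈ = Sum.[ v∉X , v≢x ∘ x∈⁅y⁆⇒x≡y _ ]′ (x∈p∪q⁻ _ _ v∈)

p⊂p∪⁅x⁆ : ∀ {n} {X : Subset n} {x} → x ∉ X → X ⊂ X ∪ ⁅ x ⁆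
p⊂p∪⁅x⁆ {x = x} x∉X = p⊆p∪q ⁅ x ⁆ , x , x∈p∪q⁺ (inj₂ (x∈⁅x⁆ x)) , x∉X

pointwise⇒∃⊎∀ : ∀ {n} {P Q : Fin n → Set} → (∀ x → P x ⊎ Q x) → ∃ P ⊎ (∀ x → Q x)
pointwise⇒∃⊎∀ {zero}  P⊎Q = inj₂ λ ()
pointwise⇒∃⊎∀ {suc n} P⊎Q with P⊎Q zero | pointwise⇒∃⊎∀ (P⊎Q ∘ suc)
... | inj₁ P0 | _             = inj₁ (zero , P0)
... | inj₂ _  | inj₁ (x , Px) = inj₁ (suc x , Px)
... | inj₂ Q0 | inj₂ Qs       = inj₂ λ { zero → Q0 ; (suc x) → Qs x }

-- Arithmetic in GF(p)

negativeInverse : ∀ {p} .{{_ : NonZero p}} → Prime p → ∀ n .{{_ : NonZero n}} → n ℕ.< p →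
                  ∃ λ ν → (1 + ν * n) % p ≡ 0
negativeInverse {suc q} p-prime n n<p with coprime-Bézout (prime⇒coprime p-prime n<p)
... | Bézout.+- x y 1+yn≡xp = y , trans (cong (_% suc q) 1+yn≡xp) (m*n%n≡0 x (suc q))
... | Bézout.-+ x y 1+xp≡yn = q * y , trans (cong (_% suc q) 1+qyn≡[1+qx]p) (m*n%n≡0 (1 + q * x) (suc q))
  where
  regroup : ∀ q x → 1 + q * (1 + x * suc q) ≡ (1 + q * x) * suc q
  regroup = solve-∀
  1+qyn≡[1+qx]p : 1 + q * y * n ≡ (1 + q * x) * suc q
  1+qyn≡[1+qx]p = begin
    1 + q * y * n          ≡⟨ cong (1 +_) (ℕ.*-assoc q y n) ⟩
    1 + q * (y * n)        ≡⟨ cong (λ t → 1 + q * t) 1+xp≡yn ⟨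
    1 + q * (1 + x * suc q) ≡⟨ regroup q x ⟩
    (1 + q * x) * suc q    ∎
    where open ≡-Reasoning

module _ {p : ℕ} .{{_ : NonZero p}} where

  private
    infix 4 _≋_
    _≋_ : ℕ → ℕ → Set
    m ≋ n = m % p ≡ n % p

    toℕ-0ₚ : toℕ (0ₚ {p}) ≡ 0
    toℕ-0ₚ = trans (toℕ-fromℕ< _) (m<n⇒m%n≡m (ℕ.>-nonZero⁻¹ p))

    toℕ-mod : ∀ m → toℕ (m mod p) ≋ m
    toℕ-mod m = trans (cong (_% p) (toℕ-fromℕ< _)) (m%n%n≡m%n m p)

    mod-cong : ∀ {m n} → m ≋ n → m mod p ≡ n mod p
    mod-cong {m} {n} m≋n = toℕ-injective (trans (toℕ-fromℕ< _) (trans m≋n (sym (toℕ-fromℕ< _))))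

    mod-toℕ : ∀ (x : Fin p) → toℕ x mod p ≡ x
    mod-toℕ x = toℕ-injective (trans (toℕ-fromℕ< _) (m<n⇒m%n≡m (toℕ<n x)))

    +-cong-≋ : ∀ {m m′ n n′} → m ≋ m′ → n ≋ n′ → m + n ≋ m′ + n′
    +-cong-≋ {m} {m′} {n} {n′} m≋m′ n≋n′ = begin
      (m + n) % p             ≡⟨ %-distribˡ-+ m n p ⟩
      (m % p + n % p) % p     ≡⟨ cong₂ (λ s t → (s + t) % p) m≋m′ n≋n′ ⟩
      (m′ % p + n′ % p) % p   ≡⟨ %-distribˡ-+ m′ n′ p ⟨
      (m′ + n′) % p           ∎
      where open ≡-Reasoning

    *-cong-≋ : ∀ {m m′ n n′} → m ≋ m′ → n ≋ n′ → m * n ≋ m′ * n′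
    *-cong-≋ {m} {m′} {n} {n′} m≋m′ n≋n′ = begin
      (m * n) % p             ≡⟨ %-distribˡ-* m n p ⟩
      (m % p * (n % p)) % p   ≡⟨ cong₂ (λ s t → (s * t) % p) m≋m′ n≋n′ ⟩
      (m′ % p * (n′ % p)) % p ≡⟨ %-distribˡ-* m′ n′ p ⟨
      (m′ * n′) % p           ∎
      where open ≡-Reasoning

  +ₚ-comm : ∀ (x y : Fin p) → x +ₚ y ≡ y +ₚ x
  +ₚ-comm x y = cong (_mod p) (ℕ.+-comm (toℕ x) (toℕ y))

  *ₚ-comm : ∀ (x y : Fin p) → x *ₚ y ≡ y *ₚ x
  *ₚ-comm x y = cong (_mod p) (ℕ.*-comm (toℕ x) (toℕ y))

  +ₚ-assoc : ∀ (x y z : Fin p) → (x +ₚ y) +ₚ z ≡ x +ₚ (y +ₚ z)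
  +ₚ-assoc x y z = mod-cong (begin
    (toℕ (x +ₚ y) + toℕ z) % p         ≡⟨ +-cong-≋ (toℕ-mod _) refl ⟩
    (toℕ x + toℕ y + toℕ z) % p        ≡⟨ cong (_% p) (ℕ.+-assoc (toℕ x) _ _) ⟩
    (toℕ x + (toℕ y + toℕ z)) % p      ≡⟨ +-cong-≋ {toℕ x} refl (toℕ-mod _) ⟨
    (toℕ x + toℕ (y +ₚ z)) % p         ∎)
    where open ≡-Reasoning

  *ₚ-assoc : ∀ (x y z : Fin p) → (x *ₚ y) *ₚ z ≡ x *ₚ (y *ₚ z)
  *ₚ-assoc x y z = mod-cong (begin
    (toℕ (x *ₚ y) * toℕ z) % p         ≡⟨ *-cong-≋ (toℕ-mod _) refl ⟩
    (toℕ x * toℕ y * toℕ z) % p        ≡⟨ cong (_% p) (ℕ.*-assoc (toℕ x) _ _) ⟩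
    (toℕ x * (toℕ y * toℕ z)) % p      ≡⟨ *-cong-≋ {toℕ x} refl (toℕ-mod _) ⟨
    (toℕ x * toℕ (y *ₚ z)) % p         ∎)
    where open ≡-Reasoning

  *ₚ-distribˡ-+ₚ : ∀ (x y z : Fin p) → x *ₚ (y +ₚ z) ≡ x *ₚ y +ₚ x *ₚ z
  *ₚ-distribˡ-+ₚ x y z = mod-cong (begin
    (toℕ x * toℕ (y +ₚ z)) % p             ≡⟨ *-cong-≋ {toℕ x} refl (toℕ-mod _) ⟩
    (toℕ x * (toℕ y + toℕ z)) % p          ≡⟨ cong (_% p) (ℕ.*-distribˡ-+ (toℕ x) _ _) ⟩
    (toℕ x * toℕ y + toℕ x * toℕ z) % p    ≡⟨ +-cong-≋ (toℕ-mod _) (toℕ-mod _) ⟨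
    (toℕ (x *ₚ y) + toℕ (x *ₚ z)) % p      ∎)
    where open ≡-Reasoning

  *ₚ-distribʳ-+ₚ : ∀ (x y z : Fin p) → (y +ₚ z) *ₚ x ≡ y *ₚ x +ₚ z *ₚ x
  *ₚ-distribʳ-+ₚ x y z = begin
    (y +ₚ z) *ₚ x          ≡⟨ *ₚ-comm _ x ⟩
    x *ₚ (y +ₚ z)          ≡⟨ *ₚ-distribˡ-+ₚ x y z ⟩
    x *ₚ y +ₚ x *ₚ z       ≡⟨ cong₂ _+ₚ_ (*ₚ-comm x y) (*ₚ-comm x z) ⟩
    y *ₚ x +ₚ z *ₚ x       ∎
    where open ≡-Reasoning

  +ₚ-identityˡ : ∀ (x : Fin p) → 0ₚ +ₚ x ≡ x
  +ₚ-identityˡ x = trans (cong (λ t → (t + toℕ x) mod p) toℕ-0ₚ) (mod-toℕ x)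

  +ₚ-identityʳ : ∀ (x : Fin p) → x +ₚ 0ₚ ≡ x
  +ₚ-identityʳ x = trans (+ₚ-comm x 0ₚ) (+ₚ-identityˡ x)

  *ₚ-zeroˡ : ∀ (x : Fin p) → 0ₚ *ₚ x ≡ 0ₚ
  *ₚ-zeroˡ x = cong (λ t → (t * toℕ x) mod p) toℕ-0ₚ

  *ₚ-zeroʳ : ∀ (x : Fin p) → x *ₚ 0ₚ ≡ 0ₚ
  *ₚ-zeroʳ x = trans (*ₚ-comm x 0ₚ) (*ₚ-zeroˡ x)

  +ₚ-interchange : ∀ (w x y z : Fin p) → (w +ₚ x) +ₚ (y +ₚ z) ≡ (w +ₚ y) +ₚ (x +ₚ z)
  +ₚ-interchange w x y z = begin
    (w +ₚ x) +ₚ (y +ₚ z)   ≡⟨ +ₚ-assoc w x _ ⟩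
    w +ₚ (x +ₚ (y +ₚ z))   ≡⟨ cong (w +ₚ_) (+ₚ-assoc x y z) ⟨
    w +ₚ ((x +ₚ y) +ₚ z)   ≡⟨ cong (λ t → w +ₚ (t +ₚ z)) (+ₚ-comm x y) ⟩
    w +ₚ ((y +ₚ x) +ₚ z)   ≡⟨ cong (w +ₚ_) (+ₚ-assoc y x z) ⟩
    w +ₚ (y +ₚ (x +ₚ z))   ≡⟨ +ₚ-assoc w y _ ⟨
    (w +ₚ y) +ₚ (x +ₚ z)   ∎
    where open ≡-Reasoning

  module _ (p-prime : Prime p) where

    private
      p∣toℕ⇒≡0ₚ : ∀ {x : Fin p} → p ∣ toℕ x → x ≡ 0ₚ
      p∣toℕ⇒≡0ₚ {x} p∣x = toℕ-injective (begin
        toℕ x      ≡⟨ m<n⇒m%n≡m (toℕ<n x) ⟨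
        toℕ x % p  ≡⟨ n∣m⇒m%n≡0 (toℕ x) p p∣x ⟩
        0          ≡⟨ toℕ-0ₚ ⟨
        toℕ 0ₚ     ∎)
        where open ≡-Reasoning

    x*ₚy≡0⇒x≡0⊎y≡0 : ∀ (x y : Fin p) → x *ₚ y ≡ 0ₚ → x ≡ 0ₚ ⊎ y ≡ 0ₚ
    x*ₚy≡0⇒x≡0⊎y≡0 x y xy≡0 =
      Sum.map p∣toℕ⇒≡0ₚ p∣toℕ⇒≡0ₚ (euclidsLemma (toℕ x) (toℕ y) p-prime p∣xy)
      where
      p∣xy : p ∣ toℕ x * toℕ y
      p∣xy = m%n≡0⇒n∣m _ p (trans (sym (toℕ-fromℕ< _)) (trans (cong toℕ xy≡0) toℕ-0ₚ))

    eliminate : ∀ {x : Fin p} → x ≢ 0ₚ → ∀ y → ∃ λ μ → y +ₚ μ *ₚ x ≡ 0ₚ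
    eliminate {x} x≢0 y = (toℕ y * ν) mod p , mod-cong (begin
      (toℕ y + toℕ (((toℕ y * ν) mod p) *ₚ x)) % p
        ≡⟨ +-cong-≋ {toℕ y} refl (trans (toℕ-mod _) (*-cong-≋ (toℕ-mod (toℕ y * ν)) refl)) ⟩
      (toℕ y + toℕ y * ν * toℕ x) % p
        ≡⟨ cong (_% p) (distribute (toℕ y) ν (toℕ x)) ⟩
      (toℕ y * (1 + ν * toℕ x)) % p
        ≡⟨ %-distribˡ-* (toℕ y) _ p ⟩
      (toℕ y % p * ((1 + ν * toℕ x) % p)) % p
        ≡⟨ cong (λ t → (toℕ y % p * t) % p) 1+νx≡0 ⟩
      (toℕ y % p * 0) % p
        ≡⟨ cong (_% p) (ℕ.*-zeroʳ (toℕ y % p)) ⟩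
      0 % p ∎)
      where
      open ≡-Reasoning
      instance
        _ : NonZero (toℕ x)
        _ = ℕ.≢-nonZero (λ x≡0 → x≢0 (toℕ-injective (trans x≡0 (sym toℕ-0ₚ))))
      distribute : ∀ a b c → a + a * b * c ≡ a * (1 + b * c)
      distribute = solve-∀
      ν = proj₁ (negativeInverse p-prime (toℕ x) (toℕ<n x))
      1+νx≡0 = proj₂ (negativeInverse p-prime (toℕ x) (toℕ<n x))

    y+μx≡0⇒μ≡0 : ∀ {y μ x : Fin p} → y ≡ 0ₚ → x ≢ 0ₚ → y +ₚ μ *ₚ x ≡ 0ₚ → μ ≡ 0ₚ
    y+μx≡0⇒μ≡0 {μ = μ} {x} refl x≢0 0+μx≡0 =
      Sum.[ id , flip contradiction x≢0 ]′
        (x*ₚy≡0⇒x≡0⊎y≡0 μ x (trans (sym (+ₚ-identityˡ (μ *ₚ x))) 0+μx≡0))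

  -- Coefficient vectors and linear dependencies

  infixl 6 _+ᶠ_
  infixl 7 _·ᶠ_

  _+ᶠ_ : ∀ {n} → (Fin n → Fin p) → (Fin n → Fin p) → Fin n → Fin p
  (e +ᶠ d) u = e u +ₚ d u

  _·ᶠ_ : ∀ {n} → Fin p → (Fin n → Fin p) → Fin n → Fin p
  (μ ·ᶠ d) u = μ *ₚ d u

  Σₚ-cong : ∀ {n} {f g : Fin n → Fin p} → (∀ u → f u ≡ g u) → Σₚ f ≡ Σₚ g
  Σₚ-cong {zero}  f≗g = refl
  Σₚ-cong {suc n} f≗g = cong₂ _+ₚ_ (f≗g zero) (Σₚ-cong (f≗g ∘ suc))

  Σₚ-zero : ∀ {n} (f : Fin n → Fin p) → (∀ u → f u ≡ 0ₚ) → Σₚ f ≡ 0ₚ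
  Σₚ-zero {zero}  f f≗0 = refl
  Σₚ-zero {suc n} f f≗0 =
    trans (cong₂ _+ₚ_ (f≗0 zero) (Σₚ-zero (f ∘ suc) (f≗0 ∘ suc))) (+ₚ-identityˡ 0ₚ)

  Σₚ-+ᶠ : ∀ {n} (f g : Fin n → Fin p) → Σₚ (f +ᶠ g) ≡ Σₚ f +ₚ Σₚ g
  Σₚ-+ᶠ {zero}  f g = sym (+ₚ-identityˡ 0ₚ)
  Σₚ-+ᶠ {suc n} f g = trans (cong (f zero +ₚ g zero +ₚ_) (Σₚ-+ᶠ (f ∘ suc) (g ∘ suc)))
                            (+ₚ-interchange (f zero) (g zero) _ _)

  Σₚ-·ᶠ : ∀ {n} (μ : Fin p) (f : Fin n → Fin p) → Σₚ (μ ·ᶠ f) ≡ μ *ₚ Σₚ f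
  Σₚ-·ᶠ {zero}  μ f = sym (*ₚ-zeroʳ μ)
  Σₚ-·ᶠ {suc n} μ f = trans (cong (μ *ₚ f zero +ₚ_) (Σₚ-·ᶠ μ (f ∘ suc)))
                            (sym (*ₚ-distribˡ-+ₚ μ (f zero) _))

  Σₚ-single : ∀ {n} (f : Fin n → Fin p) a → (∀ u → u ≢ a → f u ≡ 0ₚ) → Σₚ f ≡ f a
  Σₚ-single {suc n} f zero    f≡0 =
    trans (cong (f zero +ₚ_) (Σₚ-zero (f ∘ suc) (λ u → f≡0 (suc u) λ ())))
          (+ₚ-identityʳ (f zero))
  Σₚ-single {suc n} f (suc a) f≡0 =
    trans (cong₂ _+ₚ_ (f≡0 zero λ ()) (Σₚ-single (f ∘ suc) a (λ u u≢a → f≡0 (suc u) (u≢a ∘ suc-injective))))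
          (+ₚ-identityˡ (f (suc a)))

  Σₚ-pair : ∀ {n} (f : Fin n → Fin p) {a b} → a ≢ b →
            (∀ u → u ≢ a → u ≢ b → f u ≡ 0ₚ) → Σₚ f ≡ f a +ₚ f b
  Σₚ-pair {suc n} f {zero}  {zero}  a≢b f≡0 = contradiction refl a≢b
  Σₚ-pair {suc n} f {zero}  {suc b} a≢b f≡0 =
    cong (f zero +ₚ_) (Σₚ-single (f ∘ suc) b (λ u u≢b → f≡0 (suc u) (λ ()) (u≢b ∘ suc-injective)))
  Σₚ-pair {suc n} f {suc a} {zero}  a≢b f≡0 =
    trans (cong (f zero +ₚ_) (Σₚ-single (f ∘ suc) a (λ u u≢a → f≡0 (suc u) (u≢a ∘ suc-injective) (λ ()))))
          (+ₚ-comm (f zero) (f (suc a)))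
  Σₚ-pair {suc n} f {suc a} {suc b} a≢b f≡0 =
    trans (cong₂ _+ₚ_ (f≡0 zero (λ ()) (λ ()))
                      (Σₚ-pair (f ∘ suc) (a≢b ∘ cong suc)
                               (λ u u≢a u≢b → f≡0 (suc u) (u≢a ∘ suc-injective) (u≢b ∘ suc-injective))))
          (+ₚ-identityˡ _)

  μ≡0⇒+ᶠ-·ᶠ≡0⇒≡0 : ∀ {n} {e d : Fin n → Fin p} {μ} → μ ≡ 0ₚ →
                    (∀ u → (e +ᶠ μ ·ᶠ d) u ≡ 0ₚ) → ∀ u → e u ≡ 0ₚ
  μ≡0⇒+ᶠ-·ᶠ≡0⇒≡0 {e = e} {d} refl e+0d≡0 u =
    trans (sym (trans (cong (e u +ₚ_) (*ₚ-zeroˡ (d u))) (+ₚ-identityʳ (e u)))) (e+0d≡0 u)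

  x+μy≡0 : ∀ {x y : Fin p} μ → x ≡ 0ₚ → y ≡ 0ₚ → x +ₚ μ *ₚ y ≡ 0ₚ
  x+μy≡0 μ refl refl = trans (cong (0ₚ +ₚ_) (*ₚ-zeroʳ μ)) (+ₚ-identityˡ 0ₚ)

  isDependency-+ᶠ-·ᶠ : ∀ {m n} (A : Matrix p m n) {e d} → IsDependency A e → IsDependency A d →
                       ∀ μ → IsDependency A (e +ᶠ μ ·ᶠ d)
  isDependency-+ᶠ-·ᶠ A {e} {d} dep-e dep-d μ i = begin
    Σₚ (λ u → (e u +ₚ μ *ₚ d u) *ₚ A i u)
      ≡⟨ Σₚ-cong (λ u → trans (*ₚ-distribʳ-+ₚ (A i u) (e u) _) (cong (e u *ₚ A i u +ₚ_) (*ₚ-assoc μ (d u) (A i u)))) ⟩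
    Σₚ ((λ u → e u *ₚ A i u) +ᶠ μ ·ᶠ (λ u → d u *ₚ A i u))
      ≡⟨ Σₚ-+ᶠ (λ u → e u *ₚ A i u) (μ ·ᶠ (λ u → d u *ₚ A i u)) ⟩
    Σₚ (λ u → e u *ₚ A i u) +ₚ Σₚ (μ ·ᶠ (λ u → d u *ₚ A i u))
      ≡⟨ cong (Σₚ (λ u → e u *ₚ A i u) +ₚ_) (Σₚ-·ᶠ μ (λ u → d u *ₚ A i u)) ⟩
    Σₚ (λ u → e u *ₚ A i u) +ₚ μ *ₚ Σₚ (λ u → d u *ₚ A i u)
      ≡⟨ x+μy≡0 μ (dep-e i) (dep-d i) ⟩
    0ₚ ∎
    where open ≡-Reasoning

  supportedOn-+ᶠ-·ᶠ : ∀ {n} {e d : Fin n → Fin p} {X} → SupportedOn e X → SupportedOn d X →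
                      ∀ μ → SupportedOn (e +ᶠ μ ·ᶠ d) X
  supportedOn-+ᶠ-·ᶠ e⊆X d⊆X μ u u∉X = x+μy≡0 μ (e⊆X u u∉X) (d⊆X u u∉X)

  supportedOn-mono : ∀ {n} {c : Fin n → Fin p} {X Y} → X ⊆ Y → SupportedOn c X → SupportedOn c Y
  supportedOn-mono X⊆Y c⊆X u u∉Y = c⊆X u (u∉Y ∘ X⊆Y)

  isDependency-appendRow⁻ : ∀ {m n} (A : Matrix p m n) r c → IsDependency (appendRow A r) c →
                            IsDependency A c × Σₚ (λ u → c u *ₚ r u) ≡ 0ₚ
  isDependency-appendRow⁻ {zero}  A r c dep = (λ ()) , dep zero
  isDependency-appendRow⁻ {suc m} A r c dep =
    let dep′ , row = isDependency-appendRow⁻ (A ∘ suc) r c (dep ∘ suc)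
    in (λ { zero → dep zero ; (suc i) → dep′ i }) , row

  isDependency-appendRow⁺ : ∀ {m n} (A : Matrix p m n) r c → IsDependency A c →
                            Σₚ (λ u → c u *ₚ r u) ≡ 0ₚ → IsDependency (appendRow A r) c
  isDependency-appendRow⁺ {zero}  A r c dep row zero    = row
  isDependency-appendRow⁺ {suc m} A r c dep row zero    = dep zero
  isDependency-appendRow⁺ {suc m} A r c dep row (suc i) = isDependency-appendRow⁺ (A ∘ suc) r c (dep ∘ suc) row i

  support : ∀ {n} → (Fin n → Fin p) → Subset n
  support c = tabulate (λ u → not (does (c u Fin.≟ 0ₚ)))

  ∈-support⁻ : ∀ {n} {c : Fin n → Fin p} {u} → u ∈ support c → c u ≢ 0ₚ
  ∈-support⁻ {c = c} {u} u∈ with c u Fin.≟ 0ₚ | trans (sym (lookup∘tabulate _ u)) ([]=⇒lookup u∈)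
  ... | no cu≢0 | _ = cu≢0

  supportedOn-support : ∀ {n} (c : Fin n → Fin p) → SupportedOn c (support c)
  supportedOn-support c u u∉ with c u Fin.≟ 0ₚ in eq
  ... | yes cu≡0 = cu≡0
  ... | no  _    = contradiction (lookup⇒[]= u _ (trans (lookup∘tabulate _ u) (cong (not ∘ does) eq))) u∉

  support-⊆ : ∀ {n} {c : Fin n → Fin p} {X} → SupportedOn c X → support c ⊆ X
  support-⊆ {c = c} {X} c⊆X {u} u∈ = decidable-stable (u ∈? X) (∈-support⁻ {c = c} u∈ ∘ c⊆X u)

  NontrivialDependency : ∀ {m n} → Matrix p m n → Subset n → (Fin n → Fin p) → Set
  NontrivialDependency A X c = SupportedOn c X × IsDependency A c × ∃ λ u → c u ≢ 0ₚ

  private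
    nontrivialDependency? : ∀ {m n} (A : Matrix p m n) X c → Dec (NontrivialDependency A X c)
    nontrivialDependency? A X c =
      all? (λ u → ¬? (u ∈? X) →-dec c u Fin.≟ 0ₚ)
      ×-dec all? (λ i → Σₚ (λ u → c u *ₚ A i u) Fin.≟ 0ₚ)
      ×-dec any? (λ u → ¬? (c u Fin.≟ 0ₚ))

    nontrivialDependency-resp : ∀ {m n} (A : Matrix p m n) X {c d} → (∀ u → c u ≡ d u) →
                                NontrivialDependency A X c → NontrivialDependency A X d
    nontrivialDependency-resp A X c≗d (c⊆X , dep , u , cu≢0) =
        (λ v v∉X → trans (sym (c≗d v)) (c⊆X v v∉X))
      , (λ i → trans (Σₚ-cong (λ v → cong (_*ₚ A i v) (sym (c≗d v)))) (dep i))
      , u , cu≢0 ∘ trans (c≗d u)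

  -- Exhaustive search over the p ^ n coefficient vectors.
  independent⊎nontrivialDependency : ∀ {m n} (A : Matrix p m n) X →
                                     Independent A X ⊎ ∃ (NontrivialDependency A X)
  independent⊎nontrivialDependency {n = n} A X with any? (nontrivialDependency? A X ∘ finToFun)
  ... | yes (k , nd) = inj₂ (finToFun k , nd)
  ... | no  ¬nd      = inj₁ λ c c⊆X dep u → decidable-stable (c u Fin.≟ 0ₚ) λ cu≢0 →
          ¬nd (funToFin c , nontrivialDependency-resp A X (sym ∘ finToFun-funToFin c) (c⊆X , dep , u , cu≢0))

  dependent⇒nontrivialDependency : ∀ {m n} (A : Matrix p m n) {X} → Dependent A X →
                                   ∃ (NontrivialDependency A X)
  dependent⇒nontrivialDependency A {X} ¬ind with independent⊎nontrivialDependency A X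
  ... | inj₁ ind = contradiction ind ¬ind
  ... | inj₂ nd  = nd

  circuit⇒circuitCoeffs : ∀ {m n} (A : Matrix p m n) {C} → IsCircuit A C → ∃ (CircuitCoeffs A C)
  circuit⇒circuitCoeffs A {C} (dependent , minimal) with dependent⇒nontrivialDependency A dependent
  ... | d , d⊆C , dep , u₀ , du₀≢0 = d , dep , λ u → nonzero u , d⊆C u
    where
    nonzero : ∀ u → u ∈ C → d u ≢ 0ₚ
    nonzero u u∈C du≡0 = du₀≢0 (minimal (C - u) (x∈p⇒p-x⊂p u∈C) d d⊆C-u dep u₀)
      where
      d⊆C-u : SupportedOn d (C - u)
      d⊆C-u w w∉C-u with w Fin.≟ u
      ... | yes refl = du≡0
      ... | no  w≢u  = d⊆C w (w∉C-u ∘ flip x∈p∧x≢y⇒x∈p-y w≢u)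

  module _ (p-prime : Prime p) where

    +ᶠ-·ᶠ≡0⇒≡0 : ∀ {n} {e d : Fin n → Fin p} {μ} v → e v ≡ 0ₚ → d v ≢ 0ₚ →
                 (∀ u → (e +ᶠ μ ·ᶠ d) u ≡ 0ₚ) → ∀ u → e u ≡ 0ₚ
    +ᶠ-·ᶠ≡0⇒≡0 {μ = μ} v ev≡0 dv≢0 e+μd≡0 =
      μ≡0⇒+ᶠ-·ᶠ≡0⇒≡0 (y+μx≡0⇒μ≡0 p-prime {μ = μ} ev≡0 dv≢0 (e+μd≡0 v)) e+μd≡0

    support-isCircuit : ∀ {m n} (A : Matrix p m n) {d} → IsDependency A d → (∃ λ u → d u ≢ 0ₚ) →
      (∀ e → IsDependency A e → SupportedOn e (support d) → ∃ λ μ → ∀ u → (e +ᶠ μ ·ᶠ d) u ≡ 0ₚ) →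
      IsCircuit A (support d)
    support-isCircuit A {d} dep (u , du≢0) proportional =
        (λ ind → du≢0 (ind d (supportedOn-support d) dep u))
      , λ { D (D⊆C , v , v∈C , v∉D) e e⊆D dep-e →
              let μ , e+μd≡0 = proportional e dep-e (supportedOn-mono D⊆C e⊆D)
              in  +ᶠ-·ᶠ≡0⇒≡0 {e = e} {d} {μ} v (e⊆D v v∉D) (∈-support⁻ {c = d} v∈C) e+μd≡0 }

-- The splitting matroid

module Splitting {p : ℕ} .{{_ : NonZero p}} (p-prime : Prime p) {m n} (A : Matrix p m n)
                 (a b : Fin n) (a≢b : a ≢ b) (α : Fin p) (α≢0 : α ≢ 0ₚ) where

  A′ : Matrix p (suc m) n
  A′ = splitMatrix A a b α

  balance : (Fin n → Fin p) → Fin p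
  balance c = c a +ₚ c b

  Balanced : (Fin n → Fin p) → Set
  Balanced c = balance c ≡ 0ₚ

  AllBalanced : Set
  AllBalanced = ∀ c → IsDependency A c → Balanced c

  PCircuitOrAvoiding : Subset n → Set
  PCircuitOrAvoiding C = IsPCircuit A a b C ⊎ (a ∉ C × b ∉ C)

  balance-+ᶠ-·ᶠ : ∀ e μ d → balance (e +ᶠ μ ·ᶠ d) ≡ balance e +ₚ μ *ₚ balance d
  balance-+ᶠ-·ᶠ e μ d = begin
    (e a +ₚ μ *ₚ d a) +ₚ (e b +ₚ μ *ₚ d b)  ≡⟨ +ₚ-interchange (e a) _ (e b) _ ⟩
    (e a +ₚ e b) +ₚ (μ *ₚ d a +ₚ μ *ₚ d b)  ≡⟨ cong (balance e +ₚ_) (*ₚ-distribˡ-+ₚ μ (d a) (d b)) ⟨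
    balance e +ₚ μ *ₚ balance d            ∎
    where open ≡-Reasoning

  splitRow-Σₚ : ∀ c → Σₚ (λ u → c u *ₚ splitRow a b α u) ≡ balance c *ₚ α
  splitRow-Σₚ c = begin
    Σₚ (λ u → c u *ₚ splitRow a b α u)
      ≡⟨ Σₚ-pair _ a≢b (λ u u≢a u≢b → trans (cong (c u *ₚ_) (splitRow-outside u≢a u≢b)) (*ₚ-zeroʳ (c u))) ⟩
    c a *ₚ splitRow a b α a +ₚ c b *ₚ splitRow a b α b
      ≡⟨ cong₂ (λ s t → c a *ₚ s +ₚ c b *ₚ t) splitRow-a splitRow-b ⟩
    c a *ₚ α +ₚ c b *ₚ α
      ≡⟨ *ₚ-distribʳ-+ₚ α (c a) (c b) ⟨
    balance c *ₚ α ∎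
    where
    open ≡-Reasoning
    splitRow-outside : ∀ {u} → u ≢ a → u ≢ b → splitRow a b α u ≡ 0ₚ
    splitRow-outside {u} u≢a u≢b with u Fin.≟ a | u Fin.≟ b
    ... | yes u≡a | _        = contradiction u≡a u≢a
    ... | no  _   | yes u≡b  = contradiction u≡b u≢b
    ... | no  _   | no  _    = refl
    splitRow-a : splitRow a b α a ≡ α
    splitRow-a rewrite dec-true (a Fin.≟ a) refl = refl
    splitRow-b : splitRow a b α b ≡ α
    splitRow-b rewrite dec-true (b Fin.≟ b) refl | ∨-zeroʳ (does (b Fin.≟ a)) = refl

  isDependency-split⁻ : ∀ c → IsDependency A′ c → IsDependency A c × Balanced c
  isDependency-split⁻ c dep′ =
    let dep , row≡0 = isDependency-appendRow⁻ A (splitRow a b α) c dep′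
    in  dep , Sum.[ id , flip contradiction α≢0 ]′
                    (x*ₚy≡0⇒x≡0⊎y≡0 p-prime (balance c) α (trans (sym (splitRow-Σₚ c)) row≡0))

  isDependency-split⁺ : ∀ c → IsDependency A c → Balanced c → IsDependency A′ c
  isDependency-split⁺ c dep balanced = isDependency-appendRow⁺ A (splitRow a b α) c dep
    (trans (splitRow-Σₚ c) (trans (cong (_*ₚ α) balanced) (*ₚ-zeroˡ α)))

  independent-split⁺ : ∀ {X} → Independent A X → Independent A′ X
  independent-split⁺ ind c c⊆X = ind c c⊆X ∘ proj₁ ∘ isDependency-split⁻ c

  independent-split⁻ : AllBalanced → ∀ {X} → Independent A′ X → Independent A X
  independent-split⁻ allBalanced ind′ c c⊆X dep = ind′ c c⊆X (isDependency-split⁺ c dep (allBalanced c dep))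

  balanced-+ᶠ-·ᶠ≡0⇒≡0 : ∀ {e d μ} → Balanced e → ¬ Balanced d →
                        (∀ u → (e +ᶠ μ ·ᶠ d) u ≡ 0ₚ) → ∀ u → e u ≡ 0ₚ
  balanced-+ᶠ-·ᶠ≡0⇒≡0 {e} {d} {μ} balanced unbalanced e+μd≡0 =
    μ≡0⇒+ᶠ-·ᶠ≡0⇒≡0 (y+μx≡0⇒μ≡0 p-prime {μ = μ} balanced unbalanced balance≡0) e+μd≡0
    where
    balance≡0 : balance e +ₚ μ *ₚ balance d ≡ 0ₚ
    balance≡0 = trans (sym (balance-+ᶠ-·ᶠ e μ d))
                      (trans (cong₂ _+ₚ_ (e+μd≡0 a) (e+μd≡0 b)) (+ₚ-identityˡ 0ₚ))

  allBalanced⇒rank-split≡ : AllBalanced → ∀ {r r′} → MatroidRank A r → MatroidRank A′ r′ → r′ ≡ r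
  allBalanced⇒rank-split≡ allBalanced ((B , _ , B-ind , ∣B∣≡r) , maximum) ((Y , _ , Y-ind′ , ∣Y∣≡r′) , maximum′) =
    ℕ.≤-antisym (subst (_≤ _) ∣Y∣≡r′ (maximum Y ⊆⊤ (independent-split⁻ allBalanced Y-ind′)))
                (subst (_≤ _) ∣B∣≡r (maximum′ B ⊆⊤ (independent-split⁺ B-ind)))

  allBalanced⇒isomorphic : AllBalanced → Isomorphic A A′
  allBalanced⇒isomorphic allBalanced = ↔-id (Fin n) , λ X →
    subst (λ Z → Independent A X ⇔ Independent A′ Z) (sym (tabulate∘lookup X))
          (mk⇔ independent-split⁺ (independent-split⁻ allBalanced))

  oneSided⇒unbalanced : ∀ {C d} → CircuitCoeffs A C d → (a ∈ C × b ∉ C) ⊎ (a ∉ C × b ∈ C) →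
                        ¬ Balanced d
  oneSided⇒unbalanced {d = d} (_ , coeffs) (inj₁ (a∈C , b∉C)) balanced =
    proj₁ (coeffs a) a∈C (begin
      d a           ≡⟨ +ₚ-identityʳ (d a) ⟨
      d a +ₚ 0ₚ     ≡⟨ cong (d a +ₚ_) (proj₂ (coeffs b) b∉C) ⟨
      balance d     ≡⟨ balanced ⟩
      0ₚ            ∎)
    where open ≡-Reasoning
  oneSided⇒unbalanced {d = d} (_ , coeffs) (inj₂ (a∉C , b∈C)) balanced =
    proj₁ (coeffs b) b∈C (begin
      d b           ≡⟨ +ₚ-identityˡ (d b) ⟨
      0ₚ +ₚ d b     ≡⟨ cong (_+ₚ d b) (proj₂ (coeffs a) a∉C) ⟨
      balance d     ≡⟨ balanced ⟩
      0ₚ            ∎)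
    where open ≡-Reasoning

  npCircuit⇒unbalanced : ∀ {C} → IsNPCircuit A a b C → ∃ λ c → IsDependency A c × ¬ Balanced c
  npCircuit⇒unbalanced (circuit , np) with circuit⇒circuitCoeffs A circuit | np
  ... | d , coeffs | inj₁ oneSided        = d , proj₁ coeffs , oneSided⇒unbalanced coeffs (inj₁ oneSided)
  ... | d , coeffs | inj₂ (inj₁ oneSided) = d , proj₁ coeffs , oneSided⇒unbalanced coeffs (inj₂ oneSided)
  ... | _          | inj₂ (inj₂ (_ , _ , c , (dep , _) , unbalanced)) = c , dep , unbalanced

  allBalanced⇒pCircuitOrAvoiding : AllBalanced → ∀ C → IsCircuit A C → PCircuitOrAvoiding C
  allBalanced⇒pCircuitOrAvoiding allBalanced C circuit
    with circuit⇒circuitCoeffs A circuit | a ∈? C | b ∈? C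
  ... | d , coeffs@(dep , _) | yes a∈C | yes b∈C = inj₁ (circuit , a∈C , b∈C , d , coeffs , allBalanced d dep)
  ... | d , coeffs@(dep , _) | yes a∈C | no  b∉C =
        contradiction (allBalanced d dep) (oneSided⇒unbalanced coeffs (inj₁ (a∈C , b∉C)))
  ... | d , coeffs@(dep , _) | no  a∉C | yes b∈C =
        contradiction (allBalanced d dep) (oneSided⇒unbalanced coeffs (inj₂ (a∉C , b∈C)))
  ... | _                    | no  a∉C | no  b∉C = inj₂ (a∉C , b∉C)

  independent-split⇒∣∣≤1+ : ∀ {r Y} → (∀ Z → Independent A Z → ∣ Z ∣ ≤ r) →
                            Independent A′ Y → ∣ Y ∣ ≤ suc r
  independent-split⇒∣∣≤1+ {r} {Y} maximum ind′ with independent⊎nontrivialDependency A Y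
  ... | inj₁ ind = ℕ.m≤n⇒m≤1+n (maximum Y ind)
  ... | inj₂ (d , d⊆Y , dep , u , du≢0) =
        ℕ.≤-trans (∣p∣≤1+∣p-x∣ Y u) (ℕ.s≤s (maximum (Y - u) Y-u-independent))
    where
    unbalanced : ¬ Balanced d
    unbalanced balanced = du≢0 (ind′ d d⊆Y (isDependency-split⁺ d dep balanced) u)
    -- Adding the right multiple of d balances any dependency supported on Y - u.
    Y-u-independent : Independent A (Y - u)
    Y-u-independent e e⊆Y-u dep-e =
      +ᶠ-·ᶠ≡0⇒≡0 p-prime {e = e} {d} {μ} u (e⊆Y-u u (x∉p-x Y u)) du≢0 e+μd≡0
      where
      μ = proj₁ (eliminate p-prime unbalanced (balance e))
      e+μd≡0 : ∀ v → (e +ᶠ μ ·ᶠ d) v ≡ 0ₚ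
      e+μd≡0 = ind′ (e +ᶠ μ ·ᶠ d)
        (supportedOn-+ᶠ-·ᶠ {e = e} {d} (supportedOn-mono {c = e} (p─q⊆p Y _) e⊆Y-u) d⊆Y μ)
        (isDependency-split⁺ (e +ᶠ μ ·ᶠ d) (isDependency-+ᶠ-·ᶠ A {e} {d} dep-e dep μ)
          (trans (balance-+ᶠ-·ᶠ e μ d) (proj₂ (eliminate p-prime unbalanced (balance e)))))

  module Basis {r} (rank : MatroidRank A r) where

    B : Subset n
    B = proj₁ (proj₁ rank)

    B-independent : Independent A B
    B-independent = proj₁ (proj₂ (proj₂ (proj₁ rank)))

    ∣B∣≡r : ∣ B ∣ ≡ r
    ∣B∣≡r = proj₂ (proj₂ (proj₂ (proj₁ rank)))

    independent⇒∣∣≤r : ∀ Y → Independent A Y → ∣ Y ∣ ≤ r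
    independent⇒∣∣≤r Y = proj₂ rank Y ⊆⊤

    FundamentalDependency : Fin n → (Fin n → Fin p) → Set
    FundamentalDependency x d = IsDependency A d × SupportedOn d (B ∪ ⁅ x ⁆) × d x ≢ 0ₚ

    supportedOn-∪⁅⁆ : ∀ {x} c → SupportedOn c (B ∪ ⁅ x ⁆) → c x ≡ 0ₚ → SupportedOn c B
    supportedOn-∪⁅⁆ {x} c c⊆B∪x cx≡0 v v∉B with v Fin.≟ x
    ... | yes refl = cx≡0
    ... | no  v≢x  = c⊆B∪x v (∉-∪⁅⁆ v∉B v≢x)

    B∪⁅x⁆-dependent : ∀ {x} → x ∉ B → Dependent A (B ∪ ⁅ x ⁆)
    B∪⁅x⁆-dependent {x} x∉B ind =
      ℕ.<⇒≱ (subst (ℕ._< ∣ B ∪ ⁅ x ⁆ ∣) ∣B∣≡r (p⊂q⇒∣p∣<∣q∣ (p⊂p∪⁅x⁆ x∉B))) (independent⇒∣∣≤r _ ind)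

    fundamentalDependency : ∀ {x} → x ∉ B → ∃ (FundamentalDependency x)
    fundamentalDependency x∉B with dependent⇒nontrivialDependency A (B∪⁅x⁆-dependent x∉B)
    ... | d , d⊆B∪x , dep , u , du≢0 =
          d , dep , d⊆B∪x , λ dx≡0 → du≢0 (B-independent d (supportedOn-∪⁅⁆ d d⊆B∪x dx≡0) dep u)

    fundamental-proportional : ∀ {x d} → FundamentalDependency x d →
      ∀ e → IsDependency A e → SupportedOn e (B ∪ ⁅ x ⁆) → ∃ λ μ → ∀ u → (e +ᶠ μ ·ᶠ d) u ≡ 0ₚ
    fundamental-proportional {x} {d} (dep-d , d⊆B∪x , dx≢0) e dep-e e⊆B∪x =
      μ , B-independent (e +ᶠ μ ·ᶠ d)
            (supportedOn-∪⁅⁆ (e +ᶠ μ ·ᶠ d) (supportedOn-+ᶠ-·ᶠ {e = e} {d} e⊆B∪x d⊆B∪x μ) ex+μdx≡0)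
            (isDependency-+ᶠ-·ᶠ A {e} {d} dep-e dep-d μ)
      where
      μ = proj₁ (eliminate p-prime dx≢0 (e x))
      ex+μdx≡0 = proj₂ (eliminate p-prime dx≢0 (e x))

    BalancedFundamental : Fin n → Set
    BalancedFundamental x = x ∈ B ⊎ ∃ λ d → FundamentalDependency x d × Balanced d

    UnbalancedFundamental : Fin n → Set
    UnbalancedFundamental x = x ∉ B × ∃ λ d → FundamentalDependency x d × ¬ Balanced d

    -- Induction on a list L such that c vanishes outside B ∪ L; each x ∈ L ∖ B is
    -- removed from the support by adding a multiple of its balanced fundamental dependency.
    fundamentalBalanced⇒allBalanced : (∀ x → BalancedFundamental x) → AllBalanced
    fundamentalBalanced⇒allBalanced balancedAt c dep =
      balancedOff (allFin n) c dep λ u _ u∉L → contradiction (∈-allFin u) u∉L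
      where
      balancedOff : ∀ L c → IsDependency A c → (∀ u → u ∉ B → u ∉ₗ L → c u ≡ 0ₚ) → Balanced c
      balancedOff [] c dep c≡0 =
        trans (cong₂ _+ₚ_ (c≡0′ a) (c≡0′ b)) (+ₚ-identityˡ 0ₚ)
        where c≡0′ = B-independent c (λ u u∉B → c≡0 u u∉B λ ()) dep
      balancedOff (x ∷ L) c dep c≡0 with balancedAt x
      ... | inj₁ x∈B = balancedOff L c dep λ u u∉B u∉L →
              c≡0 u u∉B λ { (here refl) → u∉B x∈B ; (there u∈L) → u∉L u∈L }
      ... | inj₂ (d , (dep-d , d⊆B∪x , dx≢0) , balanced-d) = begin
          balance c                          ≡⟨ +ₚ-identityʳ (balance c) ⟨
          balance c +ₚ 0ₚ                    ≡⟨ cong (balance c +ₚ_) (*ₚ-zeroʳ μ) ⟨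
          balance c +ₚ μ *ₚ 0ₚ               ≡⟨ cong (λ t → balance c +ₚ μ *ₚ t) balanced-d ⟨
          balance c +ₚ μ *ₚ balance d        ≡⟨ balance-+ᶠ-·ᶠ c μ d ⟨
          balance (c +ᶠ μ ·ᶠ d)              ≡⟨ balancedOff L (c +ᶠ μ ·ᶠ d) (isDependency-+ᶠ-·ᶠ A {c} {d} dep dep-d μ) vanishes ⟩
          0ₚ                                 ∎
        where
        open ≡-Reasoning
        μ = proj₁ (eliminate p-prime dx≢0 (c x))
        vanishes : ∀ u → u ∉ B → u ∉ₗ L → (c +ᶠ μ ·ᶠ d) u ≡ 0ₚ
        vanishes u u∉B u∉L with u Fin.≟ x
        ... | yes refl = proj₂ (eliminate p-prime dx≢0 (c x))
        ... | no  u≢x  = x+μy≡0 μ (c≡0 u u∉B λ { (here u≡x) → u≢x u≡x ; (there u∈L) → u∉L u∈L })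
                                  (d⊆B∪x u (∉-∪⁅⁆ u∉B u≢x))

    unbalancedFundamental⊎balancedFundamental : ∀ x → UnbalancedFundamental x ⊎ BalancedFundamental x
    unbalancedFundamental⊎balancedFundamental x with x ∈? B
    ... | yes x∈B = inj₂ (inj₁ x∈B)
    ... | no  x∉B with fundamentalDependency x∉B
    ...   | d , fundamental with balance d Fin.≟ 0ₚ
    ...     | yes balanced   = inj₂ (inj₂ (d , fundamental , balanced))
    ...     | no  unbalanced = inj₁ (x∉B , d , fundamental , unbalanced)

    allBalanced⊎unbalancedFundamental : AllBalanced ⊎ ∃ UnbalancedFundamental
    allBalanced⊎unbalancedFundamental =
      Sum.swap (Sum.map₂ fundamentalBalanced⇒allBalanced
                 (pointwise⇒∃⊎∀ unbalancedFundamental⊎balancedFundamental))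

    module Unbalanced {x d} (x∉B : x ∉ B) (fundamental : FundamentalDependency x d)
                      (unbalanced : ¬ Balanced d) where

      B∪⁅x⁆-independent-split : Independent A′ (B ∪ ⁅ x ⁆)
      B∪⁅x⁆-independent-split e e⊆B∪x dep′ =
        let dep , balanced = isDependency-split⁻ e dep′
            μ , e+μd≡0     = fundamental-proportional fundamental e dep e⊆B∪x
        in  balanced-+ᶠ-·ᶠ≡0⇒≡0 {e} {d} {μ} balanced unbalanced e+μd≡0

      rank-split≡1+ : ∀ {r′} → MatroidRank A′ r′ → r′ ≡ suc r
      rank-split≡1+ ((Y , _ , Y-independent′ , ∣Y∣≡r′) , maximum′) = ℕ.≤-antisym
        (subst (_≤ _) ∣Y∣≡r′ (independent-split⇒∣∣≤1+ independent⇒∣∣≤r Y-independent′))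
        (ℕ.≤-trans (subst (λ k → suc k ≤ _) ∣B∣≡r (p⊂q⇒∣p∣<∣q∣ (p⊂p∪⁅x⁆ x∉B)))
                   (maximum′ _ ⊆⊤ B∪⁅x⁆-independent-split))

      fundamentalCircuit : IsCircuit A (support d)
      fundamentalCircuit = support-isCircuit p-prime A (proj₁ fundamental) (x , proj₂ (proj₂ fundamental))
        λ e dep-e e⊆C → fundamental-proportional fundamental e dep-e
                          (supportedOn-mono (support-⊆ {c = d} (proj₁ (proj₂ fundamental))) e⊆C)

      fundamentalCircuit-¬pCircuitOrAvoiding : ¬ PCircuitOrAvoiding (support d)
      fundamentalCircuit-¬pCircuitOrAvoiding (inj₂ (a∉C , b∉C)) =
        unbalanced (trans (cong₂ _+ₚ_ (supportedOn-support d a a∉C) (supportedOn-support d b b∉C))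
                          (+ₚ-identityˡ 0ₚ))
      fundamentalCircuit-¬pCircuitOrAvoiding (inj₁ (_ , a∈C , _ , e , (dep-e , coeffs) , balanced-e)) =
        proj₁ (coeffs a) a∈C (B∪⁅x⁆-independent-split e e⊆B∪x (isDependency-split⁺ e dep-e balanced-e) a)
        where
        e⊆B∪x : SupportedOn e (B ∪ ⁅ x ⁆)
        e⊆B∪x = supportedOn-mono (support-⊆ {c = d} (proj₁ (proj₂ fundamental))) (proj₂ ∘ coeffs)

    rank-split≡⇒allBalanced : ∀ {r′} → MatroidRank A′ r′ → r′ ≡ r → AllBalanced
    rank-split≡⇒allBalanced rank′ r′≡r with allBalanced⊎unbalancedFundamental
    ... | inj₁ allBalanced      = allBalanced
    ... | inj₂ (_ , x∉B , _ , fundamental , unbalanced) = contradiction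
          (trans (sym (Unbalanced.rank-split≡1+ x∉B fundamental unbalanced rank′)) r′≡r) ℕ.1+n≢n

    unbalanced⇒rank-split≡1+ : (∃ λ c → IsDependency A c × ¬ Balanced c) →
                               ∀ {r′} → MatroidRank A′ r′ → r′ ≡ suc r
    unbalanced⇒rank-split≡1+ (c , dep , unbalanced-c) with allBalanced⊎unbalancedFundamental
    ... | inj₁ allBalanced      = contradiction (allBalanced c dep) unbalanced-c
    ... | inj₂ (_ , x∉B , _ , fundamental , unbalanced) = Unbalanced.rank-split≡1+ x∉B fundamental unbalanced

    pCircuitOrAvoiding⇒allBalanced : (∀ C → IsCircuit A C → PCircuitOrAvoiding C) → AllBalanced
    pCircuitOrAvoiding⇒allBalanced circuits with allBalanced⊎unbalancedFundamental
    ... | inj₁ allBalanced      = allBalanced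
    ... | inj₂ (_ , x∉B , _ , fundamental , unbalanced) =
          contradiction (circuits _ fundamentalCircuit) fundamentalCircuit-¬pCircuitOrAvoiding
          where open Unbalanced x∉B fundamental unbalanced

mainTheorem6 : (p : ℕ) .{{_ : NonZero p}} → Prime p →
    ∀ {m n} (A : Matrix p m n) (a b : Fin n) → a ≢ b → (α : Fin p) → α ≢ 0ₚ →
    -- (1) r'(M_{a,b}) = r(M) iff every circuit is a p-circuit or avoids {a,b}
    (∀ r r' → MatroidRank A r → MatroidRank (splitMatrix A a b α) r' →
      (r' ≡ r ⇔ (∀ C → IsCircuit A C → IsPCircuit A a b C ⊎ (a ∉ C × b ∉ C))))
    -- ... and in this case M ≅ M_{a,b}
    × (∀ r r' → MatroidRank A r → MatroidRank (splitMatrix A a b α) r' →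
      r' ≡ r → Isomorphic A (splitMatrix A a b α))
    -- (2) an np-circuit forces r'(M_{a,b}) = r(M) + 1
    × ((∃ λ C → IsNPCircuit A a b C) → ∀ r r' → MatroidRank A r →
      MatroidRank (splitMatrix A a b α) r' → r' ≡ suc r)
mainTheorem6 p p-prime A a b a≢b α α≢0 =
    (λ r r′ rank rank′ → mk⇔
       (allBalanced⇒pCircuitOrAvoiding ∘ rank-split≡⇒allBalanced rank rank′)
       (λ circuits → allBalanced⇒rank-split≡ (pCircuitOrAvoiding⇒allBalanced rank circuits) rank rank′))
  , (λ r r′ rank rank′ → allBalanced⇒isomorphic ∘ rank-split≡⇒allBalanced rank rank′)
  , (λ (_ , npCircuit) r r′ rank → unbalanced⇒rank-split≡1+ rank (npCircuit⇒unbalanced npCircuit))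
  where
  open Splitting p-prime A a b a≢b α α≢0
  open Basis
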